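{- For all positive integers $m,n$, the complete bipartite graph $K_{m,n}$ is not CNL-hyperenergetic, i.e. $LE_{CN}(K_{m,n})\le LE_{CN}(K_{m+n})$.
   Context: For a finite simple graph $\mathcal{G}$ on vertices $v_1,\dots,v_p$: $\mathrm{CN}(\mathcal{G})$ has $(i,j)$-entry $|N(v_i)\cap N(v_j)|$ for $i\neq j$ (open neighbourhoods) and $0$ on the diagonal; $\mathrm{CNRS}(\mathcal{G})$ is the diagonal matrix of row sums of $\mathrm{CN}(\mathcal{G})$; $\mathrm{CNL}(\mathcal{G})=\mathrm{CNRS}(\mathcal{G})-\mathrm{CN}(\mathcal{G})$. $LE_{CN}(\mathcal{G})=\sum_\nu|\nu-tr(\mathrm{CNRS}(\mathcal{G}))/p|$ over the eigenvalues $\nu$ of $\mathrm{CNL}(\mathcal{G})$ with multiplicity. A graph $\mathcal{G}$ on $p$ vertices is CNL-hyperenergetic if $LE_{CN}(\mathcal{G})>LE_{CN}(K_p)$. -}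

module Defs where

open import Data.Bool using (Bool; true; false; _∧_; _xor_; not; if_then_else_)
open import Data.Nat as ℕ using (ℕ; zero; suc)
open import Data.Nat.Base using (_<ᵇ_)
open import Data.Fin using (Fin; zero; suc; toℕ; punchIn)
open import Data.Fin.Properties using (_≟_)
open import Data.Integer using (+_)
open import Data.Rational using (ℚ; 0ℚ; 1ℚ; _+_; _*_; _-_; -_; ∣_∣; _/_)
open import Data.Vec using (Vec; foldr)
import Data.Vec as Vec
open import Relation.Nullary.Decidable using (⌊_⌋)
open import Relation.Binary.PropositionalEquality using (_≡_)

Graph : ℕ → Set
Graph p = Fin p → Fin p → Bool

record IsSimple {p : ℕ} (G : Graph p) : Set where
  field
    symm    : ∀ i j → G i j ≡ G j i
    loopless : ∀ i → G i i ≡ false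

Σℕ : {p : ℕ} → (Fin p → ℕ) → ℕ
Σℕ {zero}  f = 0
Σℕ {suc p} f = f zero ℕ.+ Σℕ (λ i → f (suc i))

Σℚ : {p : ℕ} → (Fin p → ℚ) → ℚ
Σℚ {zero}  f = 0ℚ
Σℚ {suc p} f = f zero + Σℚ (λ i → f (suc i))

count : Bool → ℕ
count true  = 1
count false = 0

Matrix : ℕ → Set
Matrix p = Fin p → Fin p → ℚ

ℕtoℚ : ℕ → ℚ
ℕtoℚ k = + k / 1

CNℕ : {p : ℕ} → Graph p → Fin p → Fin p → ℕ
CNℕ G i j = if ⌊ i ≟ j ⌋ then 0 else Σℕ (λ k → count (G i k ∧ G j k))

CN : {p : ℕ} → Graph p → Matrix p
CN G i j = ℕtoℚ (CNℕ G i j)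

rowSum : {p : ℕ} → Graph p → Fin p → ℕ
rowSum G i = Σℕ (λ j → CNℕ G i j)

CNRS : {p : ℕ} → Graph p → Matrix p
CNRS G i j = if ⌊ i ≟ j ⌋ then ℕtoℚ (rowSum G i) else 0ℚ

CNL : {p : ℕ} → Graph p → Matrix p
CNL G i j = CNRS G i j - CN G i j

trace : {p : ℕ} → Matrix p → ℚ
trace M = Σℚ (λ i → M i i)

sign : ℕ → ℚ
sign zero = 1ℚ
sign (suc k) = - sign k

det : {p : ℕ} → Matrix p → ℚ
det {zero}  M = 1ℚ
det {suc p} M = Σℚ (λ j → sign (toℕ j) * (M zero j * det (λ r c → M (suc r) (punchIn j c))))

charMat : {p : ℕ} → ℚ → Matrix p → Matrix p
charMat x M i j = (if ⌊ i ≟ j ⌋ then x else 0ℚ) - M i j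

-- νs is the list of eigenvalues of M with multiplicity, i.e.
-- det(x I - M) = ∏ (x - ν) as polynomial functions (tested at all rational x).
IsSpectrum : {p : ℕ} → Matrix p → Vec ℚ p → Set
IsSpectrum M νs = ∀ x → det (charMat x M) ≡ foldr (λ _ → ℚ) (λ ν acc → (x - ν) * acc) 1ℚ νs

LEfrom : {p : ℕ} → Graph p → Vec ℚ p → ℚ
LEfrom {zero}  G νs = 0ℚ
LEfrom {suc p} G νs =
  foldr (λ _ → ℚ) (λ ν acc → ∣ ν - (trace (CNRS G) * (+ 1 / suc p)) ∣ + acc) 0ℚ νs

K : (p : ℕ) → Graph p
K p i j = not ⌊ i ≟ j ⌋

Kbip : (m n : ℕ) → Graph (m ℕ.+ n)
Kbip m n i j = (toℕ i <ᵇ m) xor (toℕ j <ᵇ m)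

-- In K_p any two vertices have p − 2 common neighbours; in K_{m,n} two vertices have n or m
-- common neighbours when both lie in the part of size m or n, and none otherwise.  Hence x I − CNL
-- is y I plus a block-constant matrix: y I + (p−2) J with y = x − p(p−2) for K_p, and
-- y I + diag(n J_m, m J_n) with y = x − mn for K_{m,n}.  Expanding det(y I + w J_k) along the first
-- column gives y^(k−1) (y + k w), hence the characteristic polynomials x (x − p(p−2))^(p−1) and
-- x² (x − mn)^(m+n−2).  Every eigenvalue list therefore consists of these roots, and comparing the
-- values at x = 2mn shows that 0 occurs exactly twice for K_{m,n}.  With mean row sum
-- c = mn(m+n−2)/(m+n), the energy of K_{m,n} is 2c + (m+n−2)(mn − c) = 4mn(m+n−2)/(m+n), which is
-- at most (m+n)(m+n−2) since 4mn ≤ (m+n)²; for K_p each of the p deviations is at least p − 2.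

module Submission where

open import Defs
open import Algebra.Bundles using (CommutativeRing)
open import Data.Bool using (Bool; true; false; not; _∧_; _xor_; if_then_else_)
open import Data.Bool.Properties using (if-float)
open import Data.Empty using (⊥-elim)
open import Data.Fin using (Fin; zero; suc; toℕ; punchIn)
open import Data.Fin.Properties using (_≟_; suc-injective)
import Data.Integer as ℤ
import Data.Integer.Properties as ℤP
open import Data.Nat as ℕ using (ℕ; zero; suc; z≤n; s≤s; _<ᵇ_)
open import Data.Nat.Coprimality as Coprimality using (Coprime; 1-coprimeTo)
import Data.Nat.Properties as ℕP
open import Data.Product using (Σ-syntax; _×_; _,_; proj₁; proj₂)
open import Data.Rational as ℚ using (ℚ; mkℚ; 0ℚ; 1ℚ; _+_; _*_; _-_; -_; ∣_∣; _/_; 1/_; _≤_; *≤*)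
import Data.Rational.Properties as ℚP
open import Data.Rational.Solver using (module +-*-Solver)
open import Data.Sum using (_⊎_; inj₁; inj₂; [_,_]′)
open import Data.Vec using (Vec; []; _∷_; _++_; replicate; foldr)
open import Data.Vec.Relation.Unary.All as All using (All; []; _∷_)
open import Function using (_∘_)
open import Relation.Binary.Definitions using (tri<; tri≈; tri>)
open import Relation.Binary.PropositionalEquality
open import Relation.Nullary using (Dec; yes; no)
open import Relation.Nullary.Decidable using (⌊_⌋; ⌊⌋-map′)

open CommutativeRing ℚP.+-*-commutativeRing using (semiring; commutativeSemiring)
open import Algebra.Properties.Semiring.Exp semiring using (_^_; ^-homo-*)
open import Algebra.Properties.CommutativeSemiring.Exp commutativeSemiring using (^-distrib-*)
open import Algebra.Properties.Group ℚP.+-0-group using (x∙y⁻¹≈ε⇒x≈y)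
open import Algebra.Properties.CommutativeSemigroup ℕP.+-commutativeSemigroup
  using () renaming (interchange to +-interchange)
open +-*-Solver

coprime-1 : ∀ k → Coprime k 1
coprime-1 k = Coprimality.sym (1-coprimeTo k)

ℕtoℚ≡mkℚ : ∀ k → ℕtoℚ k ≡ mkℚ (ℤ.+ k) 0 (coprime-1 k)
ℕtoℚ≡mkℚ k = ℚP.normalize-coprime (coprime-1 k)

ℕtoℚ-+ : ∀ k l → ℕtoℚ (k ℕ.+ l) ≡ ℕtoℚ k + ℕtoℚ l
ℕtoℚ-+ k l rewrite ℕtoℚ≡mkℚ k | ℕtoℚ≡mkℚ l | ℤP.*-identityʳ (ℤ.+ k) | ℤP.*-identityʳ (ℤ.+ l) = refl

ℕtoℚ-* : ∀ k l → ℕtoℚ (k ℕ.* l) ≡ ℕtoℚ k * ℕtoℚ l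
ℕtoℚ-* k l rewrite ℕtoℚ≡mkℚ k | ℕtoℚ≡mkℚ l | ℤP.+◃n≡+n (k ℕ.* l) = refl

ℕtoℚ-^ : ∀ k e → ℕtoℚ (k ℕ.^ e) ≡ ℕtoℚ k ^ e
ℕtoℚ-^ k zero    = refl
ℕtoℚ-^ k (suc e) = trans (ℕtoℚ-* k (k ℕ.^ e)) (cong (ℕtoℚ k *_) (ℕtoℚ-^ k e))

ℕtoℚ-suc : ∀ k → ℕtoℚ (suc k) ≡ 1ℚ + ℕtoℚ k
ℕtoℚ-suc k = ℕtoℚ-+ 1 k

ℕtoℚ-mono-≤ : ∀ {k l} → k ℕ.≤ l → ℕtoℚ k ≤ ℕtoℚ l
ℕtoℚ-mono-≤ {k} {l} k≤l rewrite ℕtoℚ≡mkℚ k | ℕtoℚ≡mkℚ l =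
  *≤* (subst₂ ℤ._≤_ (sym (ℤP.*-identityʳ (ℤ.+ k))) (sym (ℤP.*-identityʳ (ℤ.+ l))) (ℤ.+≤+ k≤l))

ℕtoℚ-injective : ∀ {k l} → ℕtoℚ k ≡ ℕtoℚ l → k ≡ l
ℕtoℚ-injective {k} {l} eq rewrite ℕtoℚ≡mkℚ k | ℕtoℚ≡mkℚ l = ℤP.+-injective (cong ℚ.numerator eq)

ℕtoℚ-suc≢0 : ∀ k → ℕtoℚ (suc k) ≢ 0ℚ
ℕtoℚ-suc≢0 k = ℕP.1+n≢0 ∘ ℕtoℚ-injective {suc k} {0}

ℕtoℚ-suc-inverse : ∀ k → (ℤ.+ 1 / suc k) * ℕtoℚ (suc k) ≡ 1ℚ
ℕtoℚ-suc-inverse k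
  rewrite ℚP.normalize-coprime {1} {k} (1-coprimeTo (suc k)) | ℕtoℚ≡mkℚ (suc k) =
  ℚP.*-inverseˡ (mkℚ (ℤ.+ suc k) 0 (coprime-1 (suc k)))

*-cancelʳ-≤-ℕtoℚ-suc : ∀ k {a b} → a * ℕtoℚ (suc k) ≤ b * ℕtoℚ (suc k) → a ≤ b
*-cancelʳ-≤-ℕtoℚ-suc k {a} {b} rewrite ℕtoℚ≡mkℚ (suc k) =
  ℚP.*-cancelʳ-≤-pos (mkℚ (ℤ.+ suc k) 0 (coprime-1 (suc k)))

p*q≡0⇒p≡0∨q≡0 : ∀ a b → a * b ≡ 0ℚ → a ≡ 0ℚ ⊎ b ≡ 0ℚ
p*q≡0⇒p≡0∨q≡0 a b ab≡0 with a ℚP.≟ 0ℚ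
... | yes a≡0 = inj₁ a≡0
... | no  a≢0 = inj₂ (begin
  b                  ≡⟨ ℚP.*-identityˡ b ⟨
  1ℚ * b             ≡⟨ cong (_* b) (ℚP.*-inverseˡ a) ⟨
  (1/ a * a) * b     ≡⟨ ℚP.*-assoc (1/ a) a b ⟩
  1/ a * (a * b)     ≡⟨ cong (1/ a *_) ab≡0 ⟩
  1/ a * 0ℚ          ≡⟨ ℚP.*-zeroʳ (1/ a) ⟩
  0ℚ                 ∎)
  where
  open ≡-Reasoning
  instance _ = ℚ.≢-nonZero a≢0

*-cancelʳ-≢0 : ∀ {a b c} → c ≢ 0ℚ → a * c ≡ b * c → a ≡ b
*-cancelʳ-≢0 {a} {b} {c} c≢0 ac≡bc = begin
  a                  ≡⟨ ℚP.*-identityʳ a ⟨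
  a * 1ℚ             ≡⟨ cong (a *_) (ℚP.*-inverseʳ c) ⟨
  a * (c * 1/ c)     ≡⟨ ℚP.*-assoc a c (1/ c) ⟨
  (a * c) * 1/ c     ≡⟨ cong (_* 1/ c) ac≡bc ⟩
  (b * c) * 1/ c     ≡⟨ ℚP.*-assoc b c (1/ c) ⟩
  b * (c * 1/ c)     ≡⟨ cong (b *_) (ℚP.*-inverseʳ c) ⟩
  b * 1ℚ             ≡⟨ ℚP.*-identityʳ b ⟩
  b                  ∎
  where
  open ≡-Reasoning
  instance _ = ℚ.≢-nonZero c≢0

p^k≡0⇒p≡0 : ∀ a k → a ^ k ≡ 0ℚ → a ≡ 0ℚ
p^k≡0⇒p≡0 a zero    1≡0 = ⊥-elim (ℚP.1≢0 1≡0)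
p^k≡0⇒p≡0 a (suc k) aᵏ⁺¹≡0 with p*q≡0⇒p≡0∨q≡0 a (a ^ k) aᵏ⁺¹≡0
... | inj₁ a≡0  = a≡0
... | inj₂ aᵏ≡0 = p^k≡0⇒p≡0 a k aᵏ≡0

∣0-c∣≡c : ∀ {c} → 0ℚ ≤ c → ∣ 0ℚ - c ∣ ≡ c
∣0-c∣≡c {c} 0≤c = trans (cong ∣_∣ (ℚP.+-identityˡ (- c))) (trans (ℚP.∣-p∣≡∣p∣ c) (ℚP.0≤p⇒∣p∣≡p 0≤c))

∣q-c∣≡q-c : ∀ {q c} → c ≤ q → ∣ q - c ∣ ≡ q - c
∣q-c∣≡q-c {q} {c} c≤q = ℚP.0≤p⇒∣p∣≡p (subst (_≤ q - c) (ℚP.+-inverseʳ c) (ℚP.+-monoˡ-≤ (- c) c≤q))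

^-injectiveʳ : ∀ m → 1 ℕ.< m → ∀ {a b} → m ℕ.^ a ≡ m ℕ.^ b → a ≡ b
^-injectiveʳ m 1<m {a} {b} mᵃ≡mᵇ with ℕP.<-cmp a b
... | tri< a<b _ _ = ⊥-elim (ℕP.<-irrefl mᵃ≡mᵇ (ℕP.^-monoʳ-< m 1<m a<b))
... | tri≈ _ a≡b _ = a≡b
... | tri> _ _ b<a = ⊥-elim (ℕP.<-irrefl (sym mᵃ≡mᵇ) (ℕP.^-monoʳ-< m 1<m b<a))

4mn≤[m+n]² : ∀ m n → 4 ℕ.* (m ℕ.* n) ℕ.≤ (m ℕ.+ n) ℕ.* (m ℕ.+ n)
4mn≤[m+n]² m n = [ ordered , (λ n≤m → subst₂ ℕ._≤_ (cong (4 ℕ.*_) (ℕP.*-comm n m))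
                                 (cong₂ ℕ._*_ (ℕP.+-comm n m) (ℕP.+-comm n m)) (ordered n≤m)) ]′ (ℕP.≤-total m n)
  where
  open import Data.Nat.Solver using () renaming (module +-*-Solver to ℕ-Solver)
  open ℕ-Solver using () renaming (solve to solveℕ; _:+_ to _⊕_; _:*_ to _⊗_; _:=_ to _⊜_; con to κ)
  square-gap : ∀ a d → 4 ℕ.* (a ℕ.* (a ℕ.+ d)) ℕ.≤ (a ℕ.+ (a ℕ.+ d)) ℕ.* (a ℕ.+ (a ℕ.+ d))
  square-gap a d = subst (4 ℕ.* (a ℕ.* (a ℕ.+ d)) ℕ.≤_)
    (solveℕ 2 (λ a d → κ 4 ⊗ (a ⊗ (a ⊕ d)) ⊕ d ⊗ d ⊜ (a ⊕ (a ⊕ d)) ⊗ (a ⊕ (a ⊕ d))) refl a d)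
    (ℕP.m≤m+n (4 ℕ.* (a ℕ.* (a ℕ.+ d))) (d ℕ.* d))
  ordered : ∀ {a b} → a ℕ.≤ b → 4 ℕ.* (a ℕ.* b) ℕ.≤ (a ℕ.+ b) ℕ.* (a ℕ.+ b)
  ordered {a} {b} a≤b = subst (λ b → 4 ℕ.* (a ℕ.* b) ℕ.≤ (a ℕ.+ b) ℕ.* (a ℕ.+ b))
    (ℕP.m+[n∸m]≡n a≤b) (square-gap a (b ℕ.∸ a))

suc+suc≡2+ : ∀ m n → suc m ℕ.+ suc n ≡ 2 ℕ.+ (m ℕ.+ n)
suc+suc≡2+ m n = cong suc (ℕP.+-suc m n)

⌊suc≟suc⌋ : ∀ {p} (i j : Fin p) → ⌊ suc i ≟ suc j ⌋ ≡ ⌊ i ≟ j ⌋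
⌊suc≟suc⌋ i j = ⌊⌋-map′ (cong suc) suc-injective (i ≟ j)

Σℕ-cong : ∀ {p} {f g : Fin p → ℕ} → (∀ i → f i ≡ g i) → Σℕ f ≡ Σℕ g
Σℕ-cong {zero}  f≗g = refl
Σℕ-cong {suc p} f≗g = cong₂ ℕ._+_ (f≗g zero) (Σℕ-cong (f≗g ∘ suc))

Σℕ-const : ∀ p c → Σℕ {p} (λ _ → c) ≡ p ℕ.* c
Σℕ-const zero    c = refl
Σℕ-const (suc p) c = cong (c ℕ.+_) (Σℕ-const p c)

Σℕ-+ : ∀ {p} (f g : Fin p → ℕ) → Σℕ (λ i → f i ℕ.+ g i) ≡ Σℕ f ℕ.+ Σℕ g
Σℕ-+ {zero}  f g = refl
Σℕ-+ {suc p} f g = trans (cong (f zero ℕ.+ g zero ℕ.+_) (Σℕ-+ (f ∘ suc) (g ∘ suc)))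
  (+-interchange (f zero) (g zero) (Σℕ (f ∘ suc)) (Σℕ (g ∘ suc)))

Σℕ-punctured : ∀ {p} (i : Fin p) (f : Fin p → ℕ) →
  Σℕ (λ j → if ⌊ i ≟ j ⌋ then 0 else f j) ℕ.+ f i ≡ Σℕ f
Σℕ-punctured {suc p} zero    f = ℕP.+-comm (Σℕ (λ j → f (suc j))) (f zero)
Σℕ-punctured {suc p} (suc i) f = begin
  f zero ℕ.+ Σℕ (λ j → if ⌊ suc i ≟ suc j ⌋ then 0 else f (suc j)) ℕ.+ f (suc i)
    ≡⟨ cong (λ s → f zero ℕ.+ s ℕ.+ f (suc i)) (Σℕ-cong (λ j → cong (if_then 0 else f (suc j)) (⌊suc≟suc⌋ i j))) ⟩
  f zero ℕ.+ Σℕ (λ j → if ⌊ i ≟ j ⌋ then 0 else f (suc j)) ℕ.+ f (suc i)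
    ≡⟨ ℕP.+-assoc (f zero) _ (f (suc i)) ⟩
  f zero ℕ.+ (Σℕ (λ j → if ⌊ i ≟ j ⌋ then 0 else f (suc j)) ℕ.+ f (suc i))
    ≡⟨ cong (f zero ℕ.+_) (Σℕ-punctured i (λ j → f (suc j))) ⟩
  f zero ℕ.+ Σℕ (λ j → f (suc j)) ∎
  where open ≡-Reasoning

side : ∀ {p} → ℕ → Fin p → Bool
side m i = toℕ i <ᵇ m

Σℕ-sides : ∀ m n (g : Bool → ℕ) → Σℕ {m ℕ.+ n} (λ k → g (side m k)) ≡ m ℕ.* g true ℕ.+ n ℕ.* g false
Σℕ-sides zero    n g = Σℕ-const n (g false)
Σℕ-sides (suc m) n g =
  trans (cong (g true ℕ.+_) (Σℕ-sides m n g)) (sym (ℕP.+-assoc (g true) (m ℕ.* g true) (n ℕ.* g false)))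

Σℚ-cong : ∀ {p} {f g : Fin p → ℚ} → (∀ i → f i ≡ g i) → Σℚ f ≡ Σℚ g
Σℚ-cong {zero}  f≗g = refl
Σℚ-cong {suc p} f≗g = cong₂ _+_ (f≗g zero) (Σℚ-cong (f≗g ∘ suc))

Σℚ-zero : ∀ p → Σℚ {p} (λ _ → 0ℚ) ≡ 0ℚ
Σℚ-zero zero    = refl
Σℚ-zero (suc p) = cong (0ℚ +_) (Σℚ-zero p)

Σℚ-linear : ∀ {p} a b (f g : Fin p → ℚ) → Σℚ (λ i → a * f i + b * g i) ≡ a * Σℚ f + b * Σℚ g
Σℚ-linear {zero}  a b f g = solve 2 (λ a b → con 0ℚ := a :* con 0ℚ :+ b :* con 0ℚ) refl a b
Σℚ-linear {suc p} a b f g = begin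
  (a * f zero + b * g zero) + Σℚ (λ i → a * f (suc i) + b * g (suc i))
    ≡⟨ cong ((a * f zero + b * g zero) +_) (Σℚ-linear a b (f ∘ suc) (g ∘ suc)) ⟩
  (a * f zero + b * g zero) + (a * Σℚ (f ∘ suc) + b * Σℚ (g ∘ suc))
    ≡⟨ solve 6 (λ a b f₀ g₀ F G → (a :* f₀ :+ b :* g₀) :+ (a :* F :+ b :* G) := a :* (f₀ :+ F) :+ b :* (g₀ :+ G))
         refl a b (f zero) (g zero) (Σℚ (f ∘ suc)) (Σℚ (g ∘ suc)) ⟩
  a * Σℚ f + b * Σℚ g ∎
  where open ≡-Reasoning

Σℚ-neg : ∀ {p} (f : Fin p → ℚ) → Σℚ (λ i → - f i) ≡ - Σℚ f
Σℚ-neg {zero}  f = refl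
Σℚ-neg {suc p} f = trans (cong (- f zero +_) (Σℚ-neg (f ∘ suc))) (sym (ℚP.neg-distrib-+ (f zero) (Σℚ (f ∘ suc))))

Σℚ-ℕtoℚ : ∀ {p} (f : Fin p → ℕ) → Σℚ (λ i → ℕtoℚ (f i)) ≡ ℕtoℚ (Σℕ f)
Σℚ-ℕtoℚ {zero}  f = refl
Σℚ-ℕtoℚ {suc p} f = trans (cong (ℕtoℚ (f zero) +_) (Σℚ-ℕtoℚ (f ∘ suc))) (sym (ℕtoℚ-+ (f zero) (Σℕ (f ∘ suc))))

-- Determinants by first-row Laplace expansion

minor : ∀ {p} → Matrix (suc p) → Fin (suc p) → Matrix p
minor M j r c = M (suc r) (punchIn j c)

laplaceTerm : ∀ {p} → Matrix (suc p) → Fin (suc p) → ℚ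
laplaceTerm M j = sign (toℕ j) * (M zero j * det (minor M j))

setCol₀ : ∀ {p} → Matrix (suc p) → (Fin (suc p) → ℚ) → Matrix (suc p)
setCol₀ M u i zero    = u i
setCol₀ M u i (suc j) = M i (suc j)

det-cong : ∀ {p} {M N : Matrix p} → (∀ i j → M i j ≡ N i j) → det M ≡ det N
det-cong {zero}  M≗N = refl
det-cong {suc p} M≗N = Σℚ-cong (λ j →
  cong₂ (λ e d → sign (toℕ j) * (e * d)) (M≗N zero j) (det-cong (λ r c → M≗N (suc r) (punchIn j c))))

minor-setCol₀ : ∀ {p} (M : Matrix (suc (suc p))) u j r c →
  setCol₀ (minor M (suc j)) (u ∘ suc) r c ≡ minor (setCol₀ M u) (suc j) r c
minor-setCol₀ M u j r zero    = refl
minor-setCol₀ M u j r (suc c) = refl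

det-col₀-linear : ∀ {p} (M : Matrix (suc p)) a b u v → (∀ i → M i zero ≡ a * u i + b * v i) →
  det M ≡ a * det (setCol₀ M u) + b * det (setCol₀ M v)
laplaceTerm-col₀-linear : ∀ {p} (M : Matrix (suc p)) a b u v → (∀ i → M i zero ≡ a * u i + b * v i) →
  ∀ j → laplaceTerm M j ≡ a * laplaceTerm (setCol₀ M u) j + b * laplaceTerm (setCol₀ M v) j

det-col₀-linear M a b u v col₀ =
  trans (Σℚ-cong (laplaceTerm-col₀-linear M a b u v col₀))
    (Σℚ-linear a b (laplaceTerm (setCol₀ M u)) (laplaceTerm (setCol₀ M v)))

laplaceTerm-col₀-linear M a b u v col₀ zero =
  trans (cong (λ e → sign 0 * (e * det (minor M zero))) (col₀ zero))
    (solve 6 (λ s a b u v d → s :* ((a :* u :+ b :* v) :* d) := a :* (s :* (u :* d)) :+ b :* (s :* (v :* d)))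
      refl (sign 0) a b (u zero) (v zero) (det (minor M zero)))
laplaceTerm-col₀-linear {suc p} M a b u v col₀ (suc j) =
  trans (cong (λ d → s * (e * d)) (trans
          (det-col₀-linear (minor M (suc j)) a b (u ∘ suc) (v ∘ suc) (col₀ ∘ suc))
          (cong₂ (λ x y → a * x + b * y) (det-cong (minor-setCol₀ M u j)) (det-cong (minor-setCol₀ M v j)))))
    (solve 6 (λ s e a b x y → s :* (e :* (a :* x :+ b :* y)) := a :* (s :* (e :* x)) :+ b :* (s :* (e :* y)))
      refl s e a b (det (minor (setCol₀ M u) (suc j))) (det (minor (setCol₀ M v) (suc j))))
  where
  s = sign (toℕ (suc j))
  e = M zero (suc j)

det-col₀-zero : ∀ {p} (M : Matrix (suc p)) → (∀ i → M i zero ≡ 0ℚ) → det M ≡ 0ℚ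
det-col₀-zero M col₀ = trans (det-col₀-linear M 0ℚ 0ℚ (λ _ → 0ℚ) (λ _ → 0ℚ) col₀)
  (solve 1 (λ d → con 0ℚ :* d :+ con 0ℚ :* d := con 0ℚ) refl (det (setCol₀ M (λ _ → 0ℚ))))

laplaceTerm-suc-vanish : ∀ {p} (M : Matrix (suc p)) → (∀ i → M (suc i) zero ≡ 0ℚ) →
  ∀ j → laplaceTerm M (suc j) ≡ 0ℚ
laplaceTerm-suc-vanish {suc p} M col₀ j =
  trans (cong (λ d → sign (toℕ (suc j)) * (M zero (suc j) * d)) (det-col₀-zero (minor M (suc j)) col₀))
    (solve 2 (λ s e → s :* (e :* con 0ℚ) := con 0ℚ) refl (sign (toℕ (suc j))) (M zero (suc j)))

det-expand-col₀ : ∀ {p} (M : Matrix (suc p)) → (∀ i → M (suc i) zero ≡ 0ℚ) →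
  det M ≡ M zero zero * det (minor M zero)
det-expand-col₀ {p} M col₀ = begin
  laplaceTerm M zero + Σℚ (λ j → laplaceTerm M (suc j))
    ≡⟨ cong (laplaceTerm M zero +_) (trans (Σℚ-cong (laplaceTerm-suc-vanish M col₀)) (Σℚ-zero p)) ⟩
  laplaceTerm M zero + 0ℚ
    ≡⟨ solve 2 (λ e d → con 1ℚ :* (e :* d) :+ con 0ℚ := e :* d) refl (M zero zero) (det (minor M zero)) ⟩
  M zero zero * det (minor M zero) ∎
  where open ≡-Reasoning

det-col₀-e₁ : ∀ {p} (M : Matrix (suc (suc p))) →
  M zero zero ≡ 0ℚ → M (suc zero) zero ≡ 1ℚ → (∀ i → M (suc (suc i)) zero ≡ 0ℚ) →
  det M ≡ - det (λ r c → M (punchIn (suc zero) r) (suc c))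
det-col₀-e₁ M m₀₀≡0 m₁₀≡1 col₀ = begin
  laplaceTerm M zero + Σℚ (λ j → laplaceTerm M (suc j))
    ≡⟨ cong₂ _+_ first (Σℚ-cong rest) ⟩
  0ℚ + Σℚ (λ j → - laplaceTerm R j)
    ≡⟨ trans (ℚP.+-identityˡ _) (Σℚ-neg (laplaceTerm R)) ⟩
  - det R ∎
  where
  open ≡-Reasoning
  R : Matrix _
  R r c = M (punchIn (suc zero) r) (suc c)
  first : laplaceTerm M zero ≡ 0ℚ
  first = trans (cong (λ e → 1ℚ * (e * det (minor M zero))) m₀₀≡0)
    (solve 1 (λ d → con 1ℚ :* (con 0ℚ :* d) := con 0ℚ) refl (det (minor M zero)))
  rest : ∀ j → laplaceTerm M (suc j) ≡ - laplaceTerm R j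
  rest j = trans (cong (λ d → - sign (toℕ j) * (M zero (suc j) * d))
                   (trans (det-expand-col₀ (minor M (suc j)) col₀) (cong (_* det (minor R j)) m₁₀≡1)))
    (solve 3 (λ s e d → (:- s) :* (e :* (con 1ℚ :* d)) := :- (s :* (e :* d)))
      refl (sign (toℕ j)) (M zero (suc j)) (det (minor R j)))

det-col₀≡col₁ : ∀ {p} (M : Matrix (suc (suc p))) → (∀ i → M i zero ≡ M i (suc zero)) → det M ≡ 0ℚ
laplaceTerm-suc-suc-vanish : ∀ {p} (M : Matrix (suc (suc p))) → (∀ i → M i zero ≡ M i (suc zero)) →
  ∀ j → laplaceTerm M (suc (suc j)) ≡ 0ℚ

det-col₀≡col₁ {p} M col₀≡col₁ = begin
  laplaceTerm M zero + (laplaceTerm M (suc zero) + Σℚ (λ j → laplaceTerm M (suc (suc j))))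
    ≡⟨ cong₂ (λ x y → laplaceTerm M zero + (x + y)) term₁≡-term₀
         (trans (Σℚ-cong (laplaceTerm-suc-suc-vanish M col₀≡col₁)) (Σℚ-zero p)) ⟩
  laplaceTerm M zero + (- laplaceTerm M zero + 0ℚ)
    ≡⟨ solve 1 (λ t → t :+ (:- t :+ con 0ℚ) := con 0ℚ) refl (laplaceTerm M zero) ⟩
  0ℚ ∎
  where
  open ≡-Reasoning
  minor₁≗minor₀ : ∀ r c → minor M (suc zero) r c ≡ minor M zero r c
  minor₁≗minor₀ r zero    = col₀≡col₁ (suc r)
  minor₁≗minor₀ r (suc c) = refl
  term₁≡-term₀ : laplaceTerm M (suc zero) ≡ - laplaceTerm M zero
  term₁≡-term₀ = trans (cong₂ (λ e d → - 1ℚ * (e * d)) (sym (col₀≡col₁ zero)) (det-cong minor₁≗minor₀))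
    (solve 2 (λ e d → (:- con 1ℚ) :* (e :* d) := :- (con 1ℚ :* (e :* d))) refl (M zero zero) (det (minor M zero)))

laplaceTerm-suc-suc-vanish {suc p} M col₀≡col₁ j =
  trans (cong (λ d → sign (toℕ (suc (suc j))) * (M zero (suc (suc j)) * d))
          (det-col₀≡col₁ (minor M (suc (suc j))) (col₀≡col₁ ∘ suc)))
    (solve 2 (λ s e → s :* (e :* con 0ℚ) := con 0ℚ) refl (sign (toℕ (suc (suc j)))) (M zero (suc (suc j))))

-- Determinants of y I plus a block-constant matrix

addDiag : ∀ {p} → ℚ → Matrix p → Matrix p
addDiag y M i j = (if ⌊ i ≟ j ⌋ then y else 0ℚ) + M i j

-- yI + M with the y removed from the corner (0,0)
addDiag⁻ : ∀ {p} → ℚ → Matrix (suc p) → Matrix (suc p)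
addDiag⁻ y M = setCol₀ (addDiag y M) (λ i → M i zero)

minor₀-addDiag : ∀ {p} y (M : Matrix (suc p)) r c → minor (addDiag y M) zero r c ≡ addDiag y (minor M zero) r c
minor₀-addDiag y M r c = cong (λ b → (if b then y else 0ℚ) + M (suc r) (suc c)) (⌊suc≟suc⌋ r c)

addDiag⁻-cong : ∀ {p} y {M N : Matrix (suc p)} → (∀ i j → M i j ≡ N i j) →
  ∀ i j → addDiag⁻ y M i j ≡ addDiag⁻ y N i j
addDiag⁻-cong y M≗N i zero    = M≗N i zero
addDiag⁻-cong y M≗N i (suc j) = cong ((if ⌊ i ≟ suc j ⌋ then y else 0ℚ) +_) (M≗N i (suc j))

det-addDiag-split : ∀ {p} y (M : Matrix (suc p)) →
  det (addDiag y M) ≡ y * det (addDiag y (minor M zero)) + det (addDiag⁻ y M)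
det-addDiag-split {p} y M = begin
  det (addDiag y M)
    ≡⟨ det-col₀-linear (addDiag y M) y 1ℚ e₀ (λ i → M i zero) col₀ ⟩
  y * det (setCol₀ (addDiag y M) e₀) + 1ℚ * det (addDiag⁻ y M)
    ≡⟨ cong₂ (λ d d′ → y * d + d′) e₀-expansion (ℚP.*-identityˡ _) ⟩
  y * det (addDiag y (minor M zero)) + det (addDiag⁻ y M) ∎
  where
  open ≡-Reasoning
  e₀ : Fin (suc p) → ℚ
  e₀ zero    = 1ℚ
  e₀ (suc i) = 0ℚ
  col₀ : ∀ i → addDiag y M i zero ≡ y * e₀ i + 1ℚ * M i zero
  col₀ zero    = solve 2 (λ y m → y :+ m := y :* con 1ℚ :+ con 1ℚ :* m) refl y (M zero zero)
  col₀ (suc i) = solve 2 (λ y m → con 0ℚ :+ m := y :* con 0ℚ :+ con 1ℚ :* m) refl y (M (suc i) zero)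
  e₀-expansion : det (setCol₀ (addDiag y M) e₀) ≡ det (addDiag y (minor M zero))
  e₀-expansion = trans (det-expand-col₀ (setCol₀ (addDiag y M) e₀) (λ _ → refl))
    (trans (ℚP.*-identityˡ _) (det-cong (minor₀-addDiag y M)))

det-addDiag⁻-isolated : ∀ {p} y (M : Matrix (suc p)) → (∀ i → M (suc i) zero ≡ 0ℚ) →
  det (addDiag⁻ y M) ≡ M zero zero * det (addDiag y (minor M zero))
det-addDiag⁻-isolated y M col₀ =
  trans (det-expand-col₀ (addDiag⁻ y M) col₀) (cong (M zero zero *_) (det-cong (minor₀-addDiag y M)))

-- Equal first two columns of M make column 0 of addDiag⁻ y M equal to column 1 minus y e₁.
det-addDiag⁻-twin : ∀ {p} y (M : Matrix (suc (suc p))) → (∀ i → M i (suc zero) ≡ M i zero) →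
  det (addDiag⁻ y M) ≡ y * det (addDiag⁻ y (λ r c → M (punchIn (suc zero) r) (punchIn (suc zero) c)))
det-addDiag⁻-twin {p} y M col₁≡col₀ = begin
  det (addDiag⁻ y M)
    ≡⟨ det-col₀-linear (addDiag⁻ y M) 1ℚ (- y) col₁ e₁ col₀ ⟩
  1ℚ * det (setCol₀ (addDiag⁻ y M) col₁) + - y * det (setCol₀ (addDiag⁻ y M) e₁)
    ≡⟨ cong₂ (λ d d′ → 1ℚ * d + - y * d′)
         (det-col₀≡col₁ (setCol₀ (addDiag⁻ y M) col₁) (λ _ → refl))
         (det-col₀-e₁ (setCol₀ (addDiag⁻ y M) e₁) refl refl (λ _ → refl)) ⟩
  1ℚ * 0ℚ + - y * - det R
    ≡⟨ cong (λ d → 1ℚ * 0ℚ + - y * - d) (det-cong R≗addDiag⁻M′) ⟩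
  1ℚ * 0ℚ + - y * - det (addDiag⁻ y M′)
    ≡⟨ solve 2 (λ y d → con 1ℚ :* con 0ℚ :+ (:- y) :* (:- d) := y :* d) refl y (det (addDiag⁻ y M′)) ⟩
  y * det (addDiag⁻ y M′) ∎
  where
  open ≡-Reasoning
  M′ : Matrix (suc p)
  M′ r c = M (punchIn (suc zero) r) (punchIn (suc zero) c)
  col₁ e₁ : Fin (suc (suc p)) → ℚ
  col₁ i = addDiag y M i (suc zero)
  e₁ zero          = 0ℚ
  e₁ (suc zero)    = 1ℚ
  e₁ (suc (suc i)) = 0ℚ
  col₀ : ∀ i → M i zero ≡ 1ℚ * col₁ i + - y * e₁ i
  col₀ zero = trans (sym (col₁≡col₀ zero))
    (solve 2 (λ y m → m := con 1ℚ :* (con 0ℚ :+ m) :+ (:- y) :* con 0ℚ) refl y (M zero (suc zero)))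
  col₀ (suc zero) = trans (sym (col₁≡col₀ (suc zero)))
    (solve 2 (λ y m → m := con 1ℚ :* (y :+ m) :+ (:- y) :* con 1ℚ) refl y (M (suc zero) (suc zero)))
  col₀ (suc (suc i)) = trans (sym (col₁≡col₀ (suc (suc i))))
    (solve 2 (λ y m → m := con 1ℚ :* (con 0ℚ :+ m) :+ (:- y) :* con 0ℚ) refl y (M (suc (suc i)) (suc zero)))
  R : Matrix (suc p)
  R r c = addDiag y M (punchIn (suc zero) r) (suc c)
  R≗addDiag⁻M′ : ∀ r c → R r c ≡ addDiag⁻ y M′ r c
  R≗addDiag⁻M′ zero    zero    = trans (ℚP.+-identityˡ _) (col₁≡col₀ zero)
  R≗addDiag⁻M′ (suc r) zero    = trans (ℚP.+-identityˡ _) (col₁≡col₀ (suc (suc r)))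
  R≗addDiag⁻M′ zero    (suc c) = refl
  R≗addDiag⁻M′ (suc r) (suc c) =
    cong (λ b → (if b then y else 0ℚ) + M (suc (suc r)) (suc (suc c))) (⌊suc≟suc⌋ (suc r) (suc c))

det-addDiag⁻-const : ∀ k y w → det (addDiag⁻ {k} y (λ _ _ → w)) ≡ y ^ k * w
det-addDiag⁻-const zero    y w = trans (det-addDiag⁻-isolated {0} y (λ _ _ → w) (λ ())) (ℚP.*-comm w 1ℚ)
det-addDiag⁻-const (suc k) y w = begin
  det (addDiag⁻ {suc k} y (λ _ _ → w)) ≡⟨ det-addDiag⁻-twin {k} y (λ _ _ → w) (λ _ → refl) ⟩
  y * det (addDiag⁻ {k} y (λ _ _ → w)) ≡⟨ cong (y *_) (det-addDiag⁻-const k y w) ⟩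
  y * (y ^ k * w)                ≡⟨ ℚP.*-assoc y (y ^ k) w ⟨
  y ^ suc k * w                  ∎
  where open ≡-Reasoning

det-addDiag-const : ∀ k y w → det (addDiag {suc k} y (λ _ _ → w)) ≡ y ^ k * (y + ℕtoℚ (suc k) * w)
det-addDiag-const zero    y w = begin
  det (addDiag {1} y (λ _ _ → w))            ≡⟨ det-addDiag-split {0} y (λ _ _ → w) ⟩
  y * 1ℚ + det (addDiag⁻ {0} y (λ _ _ → w))  ≡⟨ cong (y * 1ℚ +_) (det-addDiag⁻-const 0 y w) ⟩
  y * 1ℚ + 1ℚ * w                            ≡⟨ solve 2 (λ y w → y :* con 1ℚ :+ con 1ℚ :* w
                                                              := con 1ℚ :* (y :+ con 1ℚ :* w)) refl y w ⟩
  1ℚ * (y + 1ℚ * w)                          ∎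
  where open ≡-Reasoning
det-addDiag-const (suc k) y w = begin
  det (addDiag {suc (suc k)} y (λ _ _ → w))
    ≡⟨ det-addDiag-split {suc k} y (λ _ _ → w) ⟩
  y * det (addDiag {suc k} y (λ _ _ → w)) + det (addDiag⁻ {suc k} y (λ _ _ → w))
    ≡⟨ cong₂ (λ d d′ → y * d + d′) (det-addDiag-const k y w) (det-addDiag⁻-const (suc k) y w) ⟩
  y * (y ^ k * (y + ℕtoℚ (suc k) * w)) + y * y ^ k * w
    ≡⟨ solve 4 (λ y Y n w → y :* (Y :* (y :+ n :* w)) :+ y :* Y :* w := y :* Y :* (y :+ (con 1ℚ :+ n) :* w))
         refl y (y ^ k) (ℕtoℚ (suc k)) w ⟩
  y * y ^ k * (y + (1ℚ + ℕtoℚ (suc k)) * w)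
    ≡⟨ cong (λ n → y * y ^ k * (y + n * w)) (ℕtoℚ-suc (suc k)) ⟨
  y ^ suc k * (y + ℕtoℚ (suc (suc k)) * w) ∎
  where open ≡-Reasoning

sameSide : Bool → Bool → Bool
sameSide a b = not (a xor b)

blockMatrix : ∀ {p} → (Fin p → Bool) → (Bool → ℚ) → Matrix p
blockMatrix ℓ w i j = if sameSide (ℓ i) (ℓ j) then w (ℓ i) else 0ℚ

side-punchIn₁ : ∀ {p} a (r : Fin (suc p)) → side (suc (suc a)) (punchIn (suc zero) r) ≡ side (suc a) r
side-punchIn₁ a zero    = refl
side-punchIn₁ a (suc r) = refl

det-addDiag⁻-block : ∀ a b y w →
  det (addDiag⁻ y (blockMatrix {suc a ℕ.+ b} (side (suc a)) w))
    ≡ det (addDiag⁻ {a} y (λ _ _ → w true)) * det (addDiag {b} y (λ _ _ → w false))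
det-addDiag⁻-block zero    b y w = begin
  det (addDiag⁻ y (blockMatrix {suc b} (side 1) w))
    ≡⟨ det-addDiag⁻-isolated {b} y (blockMatrix (side 1) w) (λ _ → refl) ⟩
  w true * B
    ≡⟨ cong (_* B) (ℚP.*-identityʳ (w true)) ⟨
  w true * 1ℚ * B
    ≡⟨ cong (_* B) (det-addDiag⁻-isolated {0} y (λ _ _ → w true) (λ ())) ⟨
  det (addDiag⁻ {0} y (λ _ _ → w true)) * B ∎
  where
  open ≡-Reasoning
  B = det (addDiag {b} y (λ _ _ → w false))
det-addDiag⁻-block (suc a) b y w = begin
  det (addDiag⁻ y M)
    ≡⟨ det-addDiag⁻-twin y M (λ _ → refl) ⟩
  y * det (addDiag⁻ y (λ r c → M (punchIn (suc zero) r) (punchIn (suc zero) c)))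
    ≡⟨ cong (y *_) (det-cong (addDiag⁻-cong y M₁₁≗N)) ⟩
  y * det (addDiag⁻ y N)
    ≡⟨ cong (y *_) (det-addDiag⁻-block a b y w) ⟩
  y * (A⁻ * B)
    ≡⟨ ℚP.*-assoc y A⁻ B ⟨
  y * A⁻ * B
    ≡⟨ cong (_* B) (det-addDiag⁻-twin {a} y (λ _ _ → w true) (λ _ → refl)) ⟨
  det (addDiag⁻ {suc a} y (λ _ _ → w true)) * B ∎
  where
  open ≡-Reasoning
  M = blockMatrix {suc (suc a) ℕ.+ b} (side (suc (suc a))) w
  N = blockMatrix {suc a ℕ.+ b} (side (suc a)) w
  M₁₁≗N : ∀ r c → M (punchIn (suc zero) r) (punchIn (suc zero) c) ≡ N r c
  M₁₁≗N r c = cong₂ (λ s t → if sameSide s t then w s else 0ℚ) (side-punchIn₁ a r) (side-punchIn₁ a c)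
  A⁻ = det (addDiag⁻ {a} y (λ _ _ → w true))
  B = det (addDiag {b} y (λ _ _ → w false))

det-addDiag-block : ∀ a b y w →
  det (addDiag y (blockMatrix {a ℕ.+ b} (side a) w))
    ≡ det (addDiag {a} y (λ _ _ → w true)) * det (addDiag {b} y (λ _ _ → w false))
det-addDiag-block zero    b y w = sym (ℚP.*-identityˡ _)
det-addDiag-block (suc a) b y w = begin
  det (addDiag y (blockMatrix {suc a ℕ.+ b} (side (suc a)) w))
    ≡⟨ det-addDiag-split {a ℕ.+ b} y (blockMatrix (side (suc a)) w) ⟩
  y * det (addDiag y (blockMatrix {a ℕ.+ b} (side a) w))
    + det (addDiag⁻ y (blockMatrix {suc a ℕ.+ b} (side (suc a)) w))
    ≡⟨ cong₂ (λ d d′ → y * d + d′) (det-addDiag-block a b y w) (det-addDiag⁻-block a b y w) ⟩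
  y * (A * B) + A⁻ * B
    ≡⟨ solve 4 (λ y A A⁻ B → y :* (A :* B) :+ A⁻ :* B := (y :* A :+ A⁻) :* B) refl y A A⁻ B ⟩
  (y * A + A⁻) * B
    ≡⟨ cong (_* B) (det-addDiag-split {a} y (λ _ _ → w true)) ⟨
  det (addDiag {suc a} y (λ _ _ → w true)) * B ∎
  where
  open ≡-Reasoning
  A = det (addDiag {a} y (λ _ _ → w true))
  A⁻ = det (addDiag⁻ {a} y (λ _ _ → w true))
  B = det (addDiag {b} y (λ _ _ → w false))

-- Common-neighbour Laplacians

commonNeighbours : ∀ {p} → Graph p → Fin p → Fin p → ℕ
commonNeighbours G i j = Σℕ (λ k → count (G i k ∧ G j k))

-- c only has to agree with the common-neighbour counts off the diagonal; choosing its diagonal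
-- so that every row sums to s makes x I − CNL G equal to (x − s) I + c.
record CNProfile {p} (G : Graph p) (c : Fin p → Fin p → ℕ) (s : ℕ) : Set where
  field
    offDiagonal : ∀ i j → i ≢ j → commonNeighbours G i j ≡ c i j
    rowTotal    : ∀ i → Σℕ (c i) ≡ s

rowSum+diagonal : ∀ {p} {G : Graph p} {c s} → CNProfile G c s → ∀ i → rowSum G i ℕ.+ c i i ≡ s
rowSum+diagonal {G = G} {c} prof i =
  trans (cong (ℕ._+ c i i) (Σℕ-cong entry)) (trans (Σℕ-punctured i (c i)) (rowTotal i))
  where
  open CNProfile prof
  entry : ∀ j → CNℕ G i j ≡ (if ⌊ i ≟ j ⌋ then 0 else c i j)
  entry j with i ≟ j
  ... | yes _   = refl
  ... | no  i≢j = offDiagonal i j i≢j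

charMat-CNL : ∀ {p} {G : Graph p} {c s} → CNProfile G c s →
  ∀ x i j → charMat x (CNL G) i j ≡ addDiag (x - ℕtoℚ s) (λ i j → ℕtoℚ (c i j)) i j
charMat-CNL {G = G} {c} {s} prof x i j = entry (i ≟ j)
  where
  open CNProfile prof
  entry : (d : Dec (i ≡ j)) →
    (if ⌊ d ⌋ then x else 0ℚ) - ((if ⌊ d ⌋ then ℕtoℚ (rowSum G i) else 0ℚ)
                                 - ℕtoℚ (if ⌊ d ⌋ then 0 else commonNeighbours G i j))
      ≡ (if ⌊ d ⌋ then x - ℕtoℚ s else 0ℚ) + ℕtoℚ (c i j)
  entry (yes refl) = begin
    x - (ℕtoℚ (rowSum G i) - 0ℚ)
      ≡⟨ solve 3 (λ x r d → x :- (r :- con 0ℚ) := (x :- (r :+ d)) :+ d) refl x (ℕtoℚ (rowSum G i)) (ℕtoℚ (c i i)) ⟩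
    (x - (ℕtoℚ (rowSum G i) + ℕtoℚ (c i i))) + ℕtoℚ (c i i)
      ≡⟨ cong (λ t → (x - t) + ℕtoℚ (c i i))
           (trans (sym (ℕtoℚ-+ (rowSum G i) (c i i))) (cong ℕtoℚ (rowSum+diagonal prof i))) ⟩
    (x - ℕtoℚ s) + ℕtoℚ (c i i) ∎
    where open ≡-Reasoning
  entry (no i≢j) =
    trans (solve 1 (λ n → con 0ℚ :- (con 0ℚ :- n) := con 0ℚ :+ n) refl (ℕtoℚ (commonNeighbours G i j)))
      (cong (λ n → 0ℚ + ℕtoℚ n) (offDiagonal i j i≢j))

trace-CNRS : ∀ {p} (G : Graph p) → trace (CNRS G) ≡ ℕtoℚ (Σℕ (rowSum G))
trace-CNRS G = trans (Σℚ-cong diagonal) (Σℚ-ℕtoℚ (rowSum G))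
  where
  diagonal : ∀ i → CNRS G i i ≡ ℕtoℚ (rowSum G i)
  diagonal i = cong (if_then ℕtoℚ (rowSum G i) else 0ℚ) (cong ⌊_⌋ (≡-≟-identity _≟_ refl))

trace-CNRS+diagonal : ∀ {p} {G : Graph p} {c s} → CNProfile G c s →
  trace (CNRS G) + ℕtoℚ (Σℕ (λ i → c i i)) ≡ ℕtoℚ (p ℕ.* s)
trace-CNRS+diagonal {p} {G} {c} {s} prof = begin
  trace (CNRS G) + ℕtoℚ (Σℕ (λ i → c i i))
    ≡⟨ cong (_+ ℕtoℚ (Σℕ (λ i → c i i))) (trace-CNRS G) ⟩
  ℕtoℚ (Σℕ (rowSum G)) + ℕtoℚ (Σℕ (λ i → c i i))
    ≡⟨ ℕtoℚ-+ (Σℕ (rowSum G)) (Σℕ (λ i → c i i)) ⟨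
  ℕtoℚ (Σℕ (rowSum G) ℕ.+ Σℕ (λ i → c i i))
    ≡⟨ cong ℕtoℚ (sym (Σℕ-+ (rowSum G) (λ i → c i i))) ⟩
  ℕtoℚ (Σℕ (λ i → rowSum G i ℕ.+ c i i))
    ≡⟨ cong ℕtoℚ (trans (Σℕ-cong (rowSum+diagonal prof)) (Σℕ-const p s)) ⟩
  ℕtoℚ (p ℕ.* s) ∎
  where open ≡-Reasoning

count-not∧not : ∀ a b → count (not a ∧ not b) ≡ (if a then 0 else (if b then 0 else 1))
count-not∧not true  b     = refl
count-not∧not false true  = refl
count-not∧not false false = refl

K-commonNeighbours : ∀ t (i j : Fin (2 ℕ.+ t)) → i ≢ j → commonNeighbours (K (2 ℕ.+ t)) i j ≡ t
K-commonNeighbours t i j i≢j = ℕP.+-cancelʳ-≡ 2 (commonNeighbours (K (2 ℕ.+ t)) i j) t (begin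
  commonNeighbours (K (2 ℕ.+ t)) i j ℕ.+ 2
    ≡⟨ cong (ℕ._+ 2) (Σℕ-cong (λ k → count-not∧not ⌊ i ≟ k ⌋ ⌊ j ≟ k ⌋)) ⟩
  Σℕ (λ k → if ⌊ i ≟ k ⌋ then 0 else f k) ℕ.+ 2
    ≡⟨ ℕP.+-assoc _ 1 1 ⟨
  Σℕ (λ k → if ⌊ i ≟ k ⌋ then 0 else f k) ℕ.+ 1 ℕ.+ 1
    ≡⟨ cong (λ z → Σℕ (λ k → if ⌊ i ≟ k ⌋ then 0 else f k) ℕ.+ z ℕ.+ 1) fi≡1 ⟨
  Σℕ (λ k → if ⌊ i ≟ k ⌋ then 0 else f k) ℕ.+ f i ℕ.+ 1
    ≡⟨ cong (ℕ._+ 1) (Σℕ-punctured i f) ⟩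
  Σℕ f ℕ.+ 1
    ≡⟨ Σℕ-punctured j (λ _ → 1) ⟩
  Σℕ {2 ℕ.+ t} (λ _ → 1)
    ≡⟨ Σℕ-const (2 ℕ.+ t) 1 ⟩
  (2 ℕ.+ t) ℕ.* 1
    ≡⟨ trans (ℕP.*-identityʳ (2 ℕ.+ t)) (ℕP.+-comm 2 t) ⟩
  t ℕ.+ 2 ∎)
  where
  open ≡-Reasoning
  f : Fin (2 ℕ.+ t) → ℕ
  f k = if ⌊ j ≟ k ⌋ then 0 else 1
  fi≡1 : f i ≡ 1
  fi≡1 = cong (if_then 0 else 1) (cong ⌊_⌋ (≢-≟-identity _≟_ (i≢j ∘ sym)))

K-profile : ∀ t → CNProfile (K (2 ℕ.+ t)) (λ _ _ → t) ((2 ℕ.+ t) ℕ.* t)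
K-profile t = record
  { offDiagonal = K-commonNeighbours t
  ; rowTotal    = λ _ → Σℕ-const (2 ℕ.+ t) t
  }

otherSideSize : ℕ → ℕ → Bool → ℕ
otherSideSize m n true  = n
otherSideSize m n false = m

sideCN : ℕ → ℕ → Bool → Bool → ℕ
sideCN m n a b = if sameSide a b then otherSideSize m n a else 0

bipartiteCN : ∀ {p} → ℕ → ℕ → Fin p → Fin p → ℕ
bipartiteCN m n i j = sideCN m n (side m i) (side m j)

count-by-sides : ∀ m n a b →
  m ℕ.* count ((a xor true) ∧ (b xor true)) ℕ.+ n ℕ.* count ((a xor false) ∧ (b xor false))
    ≡ sideCN m n a b
count-by-sides m n true  true  = cong₂ ℕ._+_ (ℕP.*-zeroʳ m) (ℕP.*-identityʳ n)
count-by-sides m n true  false = cong₂ ℕ._+_ (ℕP.*-zeroʳ m) (ℕP.*-zeroʳ n)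
count-by-sides m n false true  = cong₂ ℕ._+_ (ℕP.*-zeroʳ m) (ℕP.*-zeroʳ n)
count-by-sides m n false false = trans (cong₂ ℕ._+_ (ℕP.*-identityʳ m) (ℕP.*-zeroʳ n)) (ℕP.+-identityʳ m)

Kbip-profile : ∀ m n → CNProfile (Kbip m n) (bipartiteCN m n) (m ℕ.* n)
Kbip-profile m n = record
  { offDiagonal = λ i j _ → trans (Σℕ-sides m n (λ t → count ((side m i xor t) ∧ (side m j xor t))))
                                  (count-by-sides m n (side m i) (side m j))
  ; rowTotal    = λ i → trans (Σℕ-sides m n (sideCN m n (side m i))) (total (side m i))
  }
  where
  total : ∀ a → m ℕ.* sideCN m n a true ℕ.+ n ℕ.* sideCN m n a false ≡ m ℕ.* n
  total true  = trans (cong (m ℕ.* n ℕ.+_) (ℕP.*-zeroʳ n)) (ℕP.+-identityʳ (m ℕ.* n))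
  total false = trans (cong (ℕ._+ n ℕ.* m) (ℕP.*-zeroʳ m)) (ℕP.*-comm n m)

charPoly-K : ∀ t x → det (charMat x (CNL (K (2 ℕ.+ t)))) ≡ x ^ 1 * (x - ℕtoℚ ((2 ℕ.+ t) ℕ.* t)) ^ suc t
charPoly-K t x = begin
  det (charMat x (CNL (K (2 ℕ.+ t))))
    ≡⟨ det-cong (charMat-CNL (K-profile t) x) ⟩
  det (addDiag {2 ℕ.+ t} (x - r) (λ _ _ → ℕtoℚ t))
    ≡⟨ det-addDiag-const (suc t) (x - r) (ℕtoℚ t) ⟩
  (x - r) ^ suc t * ((x - r) + ℕtoℚ (2 ℕ.+ t) * ℕtoℚ t)
    ≡⟨ cong (λ z → (x - r) ^ suc t * ((x - r) + z)) (ℕtoℚ-* (2 ℕ.+ t) t) ⟨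
  (x - r) ^ suc t * ((x - r) + r)
    ≡⟨ solve 3 (λ x r Y → Y :* ((x :- r) :+ r) := x :^ 1 :* Y) refl x r ((x - r) ^ suc t) ⟩
  x ^ 1 * (x - r) ^ suc t ∎
  where
  open ≡-Reasoning
  r = ℕtoℚ ((2 ℕ.+ t) ℕ.* t)

charPoly-Kbip : ∀ m′ n′ x → let q = ℕtoℚ (suc m′ ℕ.* suc n′) in
  det (charMat x (CNL (Kbip (suc m′) (suc n′)))) ≡ x ^ 2 * (x - q) ^ (m′ ℕ.+ n′)
charPoly-Kbip m′ n′ x = begin
  det (charMat x (CNL (Kbip m n)))
    ≡⟨ det-cong (charMat-CNL (Kbip-profile m n) x) ⟩
  det (addDiag {m ℕ.+ n} y (λ i j → ℕtoℚ (bipartiteCN m n i j)))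
    ≡⟨ det-cong {m ℕ.+ n} (λ i j → cong ((if ⌊ i ≟ j ⌋ then y else 0ℚ) +_)
         (if-float ℕtoℚ (sameSide (side m i) (side m j)) {otherSideSize m n (side m i)} {0})) ⟩
  det (addDiag {m ℕ.+ n} y (blockMatrix (side m) w))
    ≡⟨ det-addDiag-block m n y w ⟩
  det (addDiag {m} y (λ _ _ → ℕtoℚ n)) * det (addDiag {n} y (λ _ _ → ℕtoℚ m))
    ≡⟨ cong₂ _*_ (det-addDiag-const m′ y (ℕtoℚ n)) (det-addDiag-const n′ y (ℕtoℚ m)) ⟩
  y ^ m′ * (y + ℕtoℚ m * ℕtoℚ n) * (y ^ n′ * (y + ℕtoℚ n * ℕtoℚ m))
    ≡⟨ cong₂ (λ u v → y ^ m′ * (y + u) * (y ^ n′ * (y + v))) (ℕtoℚ-* m n)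
         (trans (cong ℕtoℚ (ℕP.*-comm m n)) (ℕtoℚ-* n m)) ⟨
  y ^ m′ * (y + q) * (y ^ n′ * (y + q))
    ≡⟨ solve 4 (λ x q A B → A :* ((x :- q) :+ q) :* (B :* ((x :- q) :+ q)) := x :^ 2 :* (A :* B))
         refl x q (y ^ m′) (y ^ n′) ⟩
  x ^ 2 * (y ^ m′ * y ^ n′)
    ≡⟨ cong (x ^ 2 *_) (^-homo-* y m′ n′) ⟨
  x ^ 2 * y ^ (m′ ℕ.+ n′) ∎
  where
  open ≡-Reasoning
  m = suc m′
  n = suc n′
  q = ℕtoℚ (m ℕ.* n)
  y = x - q
  w : Bool → ℚ
  w b = ℕtoℚ (otherSideSize m n b)

-- Spectra and energies

-- IsSpectrum M νs unfolds to ∀ x → det (charMat x M) ≡ rootProduct x νs, and LEfrom G νs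
-- (for G on suc p vertices) to absDevSum (meanRowSum G) νs.
rootProduct : ∀ {k} → ℚ → Vec ℚ k → ℚ
rootProduct x = foldr (λ _ → ℚ) (λ ν acc → (x - ν) * acc) 1ℚ

absDevSum : ∀ {k} → ℚ → Vec ℚ k → ℚ
absDevSum c = foldr (λ _ → ℚ) (λ ν acc → ∣ ν - c ∣ + acc) 0ℚ

meanRowSum : ∀ {p} → Graph (suc p) → ℚ
meanRowSum {p} G = trace (CNRS G) * (ℤ.+ 1 / suc p)

rootProduct-++ : ∀ {k l} x (u : Vec ℚ k) (v : Vec ℚ l) → rootProduct x (u ++ v) ≡ rootProduct x u * rootProduct x v
rootProduct-++ x []      v = sym (ℚP.*-identityˡ (rootProduct x v))
rootProduct-++ x (ν ∷ u) v =
  trans (cong ((x - ν) *_) (rootProduct-++ x u v)) (sym (ℚP.*-assoc (x - ν) (rootProduct x u) (rootProduct x v)))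

rootProduct-0∷replicate : ∀ x k q → rootProduct x (0ℚ ∷ replicate k q) ≡ x * (x - q) ^ k
rootProduct-0∷replicate x k q = cong₂ _*_ (ℚP.+-identityʳ x) (replicate-factors k)
  where
  replicate-factors : ∀ k → rootProduct x (replicate k q) ≡ (x - q) ^ k
  replicate-factors zero    = refl
  replicate-factors (suc k) = cong ((x - q) *_) (replicate-factors k)

rootProduct-vanishes : ∀ {k} (νs : Vec ℚ k) → All (λ ν → rootProduct ν νs ≡ 0ℚ) νs
rootProduct-vanishes []       = []
rootProduct-vanishes (ν ∷ νs) =
  trans (cong (_* rootProduct ν νs) (ℚP.+-inverseʳ ν)) (ℚP.*-zeroˡ (rootProduct ν νs))
  ∷ All.map (λ {μ} e → trans (cong ((μ - ν) *_) e) (ℚP.*-zeroʳ (μ - ν))) (rootProduct-vanishes νs)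

spectrum-roots : ∀ {k} (M : Matrix k) (f : ℚ → ℚ) → (∀ x → det (charMat x M) ≡ f x) →
  ∀ {νs} → IsSpectrum M νs → All (λ ν → f ν ≡ 0ℚ) νs
spectrum-roots M f charPoly {νs} spec =
  All.map (λ {ν} e → trans (sym (charPoly ν)) (trans (spec ν) e)) (rootProduct-vanishes νs)

monomial-root : ∀ {x q} a b → x ^ a * (x - q) ^ b ≡ 0ℚ → x ≡ 0ℚ ⊎ x ≡ q
monomial-root {x} {q} a b e with p*q≡0⇒p≡0∨q≡0 (x ^ a) ((x - q) ^ b) e
... | inj₁ xᵃ≡0 = inj₁ (p^k≡0⇒p≡0 x a xᵃ≡0)
... | inj₂ yᵇ≡0 = inj₂ (x∙y⁻¹≈ε⇒x≈y x q (p^k≡0⇒p≡0 (x - q) b yᵇ≡0))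

record Census (q : ℚ) {k} (νs : Vec ℚ k) : Set where
  field
    #0 #q        : ℕ
    #0+#q≡k      : #0 ℕ.+ #q ≡ k
    rootProduct≡ : ∀ x → rootProduct x νs ≡ x ^ #0 * (x - q) ^ #q
    absDevSum≡   : ∀ c → absDevSum c νs ≡ ℕtoℚ #0 * ∣ 0ℚ - c ∣ + ℕtoℚ #q * ∣ q - c ∣

census : ∀ q {k} (νs : Vec ℚ k) → All (λ ν → ν ≡ 0ℚ ⊎ ν ≡ q) νs → Census q νs
census q [] [] = record
  { #0 = 0 ; #q = 0 ; #0+#q≡k = refl ; rootProduct≡ = λ _ → refl
  ; absDevSum≡ = λ c → solve 2 (λ a b → con 0ℚ := con 0ℚ :* a :+ con 0ℚ :* b) refl ∣ 0ℚ - c ∣ ∣ q - c ∣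
  }
census q (ν ∷ νs) (inj₁ refl ∷ rest) = record
  { #0 = suc #0 ; #q = #q ; #0+#q≡k = cong suc #0+#q≡k
  ; rootProduct≡ = λ x → trans (cong ((x - 0ℚ) *_) (rootProduct≡ x))
      (solve 3 (λ x X Y → (x :- con 0ℚ) :* (X :* Y) := x :* X :* Y) refl x (x ^ #0) ((x - q) ^ #q))
  ; absDevSum≡ = λ c → trans (cong (∣ 0ℚ - c ∣ +_) (absDevSum≡ c))
      (trans (solve 4 (λ a b z o → a :+ (z :* a :+ o :* b) := (con 1ℚ :+ z) :* a :+ o :* b)
                refl ∣ 0ℚ - c ∣ ∣ q - c ∣ (ℕtoℚ #0) (ℕtoℚ #q))
             (cong (λ z → z * ∣ 0ℚ - c ∣ + ℕtoℚ #q * ∣ q - c ∣) (sym (ℕtoℚ-suc #0))))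
  }
  where open Census (census q νs rest)
census q (ν ∷ νs) (inj₂ refl ∷ rest) = record
  { #0 = #0 ; #q = suc #q ; #0+#q≡k = trans (ℕP.+-suc #0 #q) (cong suc #0+#q≡k)
  ; rootProduct≡ = λ x → trans (cong ((x - q) *_) (rootProduct≡ x))
      (solve 3 (λ y X Y → y :* (X :* Y) := X :* (y :* Y)) refl (x - q) (x ^ #0) ((x - q) ^ #q))
  ; absDevSum≡ = λ c → trans (cong (∣ q - c ∣ +_) (absDevSum≡ c))
      (trans (solve 4 (λ a b z o → b :+ (z :* a :+ o :* b) := z :* a :+ (con 1ℚ :+ o) :* b)
                refl ∣ 0ℚ - c ∣ ∣ q - c ∣ (ℕtoℚ #0) (ℕtoℚ #q))
             (cong (λ o → ℕtoℚ #0 * ∣ 0ℚ - c ∣ + o * ∣ q - c ∣) (sym (ℕtoℚ-suc #q))))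
  }
  where open Census (census q νs rest)

-- Evaluating both sides at x = 2q leaves 2^z q^(z+o) = 2^z′ q^(z′+o′).
zero-multiplicity : ∀ {q} → q ≢ 0ℚ → ∀ {z o z′ o′} → z ℕ.+ o ≡ z′ ℕ.+ o′ →
  (∀ x → x ^ z * (x - q) ^ o ≡ x ^ z′ * (x - q) ^ o′) → z ≡ z′
zero-multiplicity {q} q≢0 {z} {o} {z′} {o′} same-degree same-poly =
  ^-injectiveʳ 2 (s≤s (s≤s z≤n)) (ℕtoℚ-injective (*-cancelʳ-≢0 qᵈ≢0 (begin
    ℕtoℚ (2 ℕ.^ z) * q ^ (z′ ℕ.+ o′)       ≡⟨ cong (λ d → ℕtoℚ (2 ℕ.^ z) * q ^ d) same-degree ⟨
    ℕtoℚ (2 ℕ.^ z) * q ^ (z ℕ.+ o)         ≡⟨ at-2q z o ⟨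
    (q + q) ^ z * ((q + q) - q) ^ o        ≡⟨ same-poly (q + q) ⟩
    (q + q) ^ z′ * ((q + q) - q) ^ o′      ≡⟨ at-2q z′ o′ ⟩
    ℕtoℚ (2 ℕ.^ z′) * q ^ (z′ ℕ.+ o′)      ∎)))
  where
  open ≡-Reasoning
  qᵈ≢0 : q ^ (z′ ℕ.+ o′) ≢ 0ℚ
  qᵈ≢0 = q≢0 ∘ p^k≡0⇒p≡0 q (z′ ℕ.+ o′)
  at-2q : ∀ a b → (q + q) ^ a * ((q + q) - q) ^ b ≡ ℕtoℚ (2 ℕ.^ a) * q ^ (a ℕ.+ b)
  at-2q a b = begin
    (q + q) ^ a * ((q + q) - q) ^ b
      ≡⟨ cong₂ (λ u v → u ^ a * v ^ b) (solve 1 (λ q → q :+ q := con (ℕtoℚ 2) :* q) refl q)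
                                        (solve 1 (λ q → (q :+ q) :- q := q) refl q) ⟩
    (ℕtoℚ 2 * q) ^ a * q ^ b        ≡⟨ cong (_* q ^ b) (^-distrib-* (ℕtoℚ 2) q a) ⟩
    ℕtoℚ 2 ^ a * q ^ a * q ^ b      ≡⟨ ℚP.*-assoc (ℕtoℚ 2 ^ a) (q ^ a) (q ^ b) ⟩
    ℕtoℚ 2 ^ a * (q ^ a * q ^ b)    ≡⟨ cong₂ _*_ (ℕtoℚ-^ 2 a) (^-homo-* q a b) ⟨
    ℕtoℚ (2 ℕ.^ a) * q ^ (a ℕ.+ b)  ∎

absDevSum-≥ : ∀ {k} c d (νs : Vec ℚ k) → All (λ ν → d ≤ ∣ ν - c ∣) νs → ℕtoℚ k * d ≤ absDevSum c νs
absDevSum-≥ c d []       []       = ℚP.≤-reflexive (ℚP.*-zeroˡ d)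
absDevSum-≥ {suc k} c d (ν ∷ νs) (d≤ν ∷ rest) = begin
  ℕtoℚ (suc k) * d    ≡⟨ cong (_* d) (ℕtoℚ-suc k) ⟩
  (1ℚ + ℕtoℚ k) * d   ≡⟨ solve 2 (λ d n → (con 1ℚ :+ n) :* d := d :+ n :* d) refl d (ℕtoℚ k) ⟩
  d + ℕtoℚ k * d      ≤⟨ ℚP.+-mono-≤ d≤ν (absDevSum-≥ c d νs rest) ⟩
  ∣ ν - c ∣ + absDevSum c νs ∎
  where open ℚP.≤-Reasoning

meanRowSum-* : ∀ {p} (G : Graph (suc p)) → meanRowSum G * ℕtoℚ (suc p) ≡ trace (CNRS G)
meanRowSum-* {p} G = begin
  trace (CNRS G) * (ℤ.+ 1 / suc p) * ℕtoℚ (suc p)    ≡⟨ ℚP.*-assoc (trace (CNRS G)) _ _ ⟩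
  trace (CNRS G) * ((ℤ.+ 1 / suc p) * ℕtoℚ (suc p))  ≡⟨ cong (trace (CNRS G) *_) (ℕtoℚ-suc-inverse p) ⟩
  trace (CNRS G) * 1ℚ                                ≡⟨ ℚP.*-identityʳ (trace (CNRS G)) ⟩
  trace (CNRS G) ∎
  where open ≡-Reasoning

K-meanRowSum : ∀ t → meanRowSum (K (2 ℕ.+ t)) ≡ ℕtoℚ ((1 ℕ.+ t) ℕ.* t)
K-meanRowSum t = *-cancelʳ-≢0 (ℕtoℚ-suc≢0 (suc t)) (begin
  meanRowSum (K p) * P                ≡⟨ meanRowSum-* (K p) ⟩
  trace (CNRS (K p))                  ≡⟨ solve 2 (λ T D → T := (T :+ D) :- D) refl (trace (CNRS (K p))) (ℕtoℚ D) ⟩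
  trace (CNRS (K p)) + ℕtoℚ D - ℕtoℚ D
    ≡⟨ cong₂ _-_ (trace-CNRS+diagonal (K-profile t)) (cong ℕtoℚ (Σℕ-const p t)) ⟩
  ℕtoℚ (p ℕ.* (p ℕ.* t)) - ℕtoℚ (p ℕ.* t)
    ≡⟨ cong₂ _-_ (trans (ℕtoℚ-* p (p ℕ.* t)) (cong (P *_) (ℕtoℚ-+ t a))) (ℕtoℚ-* p t) ⟩
  P * (ℕtoℚ t + A) - P * ℕtoℚ t
    ≡⟨ solve 3 (λ P T A → P :* (T :+ A) :- P :* T := A :* P) refl P (ℕtoℚ t) A ⟩
  A * P ∎)
  where
  open ≡-Reasoning
  p = 2 ℕ.+ t
  P = ℕtoℚ p
  a = (1 ℕ.+ t) ℕ.* t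
  A = ℕtoℚ a
  D = Σℕ {p} (λ _ → t)

K-spectrum : ∀ {p t} → p ≡ 2 ℕ.+ t → Σ[ β ∈ Vec ℚ p ] IsSpectrum (CNL (K p)) β
K-spectrum {t = t} refl = 0ℚ ∷ replicate (suc t) r , λ x →
  trans (charPoly-K t x)
    (trans (cong (_* (x - r) ^ suc t) (ℚP.*-identityʳ x)) (sym (rootProduct-0∷replicate x (suc t) r)))
  where r = ℕtoℚ ((2 ℕ.+ t) ℕ.* t)

K-energy-lower : ∀ {p t} → p ≡ 2 ℕ.+ t → (β : Vec ℚ p) → IsSpectrum (CNL (K p)) β →
  ℕtoℚ p * ℕtoℚ t ≤ LEfrom (K p) β
K-energy-lower {t = t} refl β spec =
  subst (λ c → ℕtoℚ (2 ℕ.+ t) * ℕtoℚ t ≤ absDevSum c β) (sym (K-meanRowSum t))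
    (absDevSum-≥ A (ℕtoℚ t) β (All.map (λ {ν} → deviation {ν}) roots))
  where
  A = ℕtoℚ ((1 ℕ.+ t) ℕ.* t)
  r = ℕtoℚ ((2 ℕ.+ t) ℕ.* t)
  roots : All (λ ν → ν ^ 1 * (ν - r) ^ suc t ≡ 0ℚ) β
  roots = spectrum-roots (CNL (K (2 ℕ.+ t))) (λ x → x ^ 1 * (x - r) ^ suc t) (charPoly-K t) spec
  0≤t : 0ℚ ≤ ℕtoℚ t
  0≤t = ℕtoℚ-mono-≤ {0} {t} z≤n
  t≤A : ℕtoℚ t ≤ A
  t≤A = ℕtoℚ-mono-≤ (ℕP.m≤m+n t (t ℕ.* t))
  deviation : ∀ {ν} → ν ^ 1 * (ν - r) ^ suc t ≡ 0ℚ → ℕtoℚ t ≤ ∣ ν - A ∣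
  deviation {ν} e with monomial-root {ν} 1 (suc t) e
  ... | inj₁ refl = subst (ℕtoℚ t ≤_) (sym (∣0-c∣≡c (ℚP.≤-trans 0≤t t≤A))) t≤A
  ... | inj₂ refl = ℚP.≤-reflexive (sym (begin
    ∣ r - A ∣              ≡⟨ cong (λ z → ∣ z - A ∣) (ℕtoℚ-+ t ((1 ℕ.+ t) ℕ.* t)) ⟩
    ∣ ℕtoℚ t + A - A ∣     ≡⟨ cong ∣_∣ (solve 2 (λ T A → T :+ A :- A := T) refl (ℕtoℚ t) A) ⟩
    ∣ ℕtoℚ t ∣             ≡⟨ ℚP.0≤p⇒∣p∣≡p 0≤t ⟩
    ℕtoℚ t ∎))
    where open ≡-Reasoning

Kbip-spectrum : ∀ m′ n′ → Σ[ α ∈ Vec ℚ (suc m′ ℕ.+ suc n′) ] IsSpectrum (CNL (Kbip (suc m′) (suc n′))) α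
Kbip-spectrum m′ n′ = (0ℚ ∷ replicate m′ q) ++ (0ℚ ∷ replicate n′ q) , λ x → begin
  det (charMat x (CNL (Kbip (suc m′) (suc n′))))
    ≡⟨ charPoly-Kbip m′ n′ x ⟩
  x ^ 2 * (x - q) ^ (m′ ℕ.+ n′)
    ≡⟨ cong (x ^ 2 *_) (^-homo-* (x - q) m′ n′) ⟩
  x ^ 2 * ((x - q) ^ m′ * (x - q) ^ n′)
    ≡⟨ solve 3 (λ x A B → x :^ 2 :* (A :* B) := x :* A :* (x :* B)) refl x ((x - q) ^ m′) ((x - q) ^ n′) ⟩
  x * (x - q) ^ m′ * (x * (x - q) ^ n′)
    ≡⟨ cong₂ _*_ (rootProduct-0∷replicate x m′ q) (rootProduct-0∷replicate x n′ q) ⟨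
  rootProduct x (0ℚ ∷ replicate m′ q) * rootProduct x (0ℚ ∷ replicate n′ q)
    ≡⟨ rootProduct-++ x (0ℚ ∷ replicate m′ q) (0ℚ ∷ replicate n′ q) ⟨
  rootProduct x ((0ℚ ∷ replicate m′ q) ++ (0ℚ ∷ replicate n′ q)) ∎
  where
  open ≡-Reasoning
  q = ℕtoℚ (suc m′ ℕ.* suc n′)

Kbip-meanRowSum : ∀ m′ n′ →
  meanRowSum (Kbip (suc m′) (suc n′)) * ℕtoℚ (suc m′ ℕ.+ suc n′) ≡ ℕtoℚ (suc m′ ℕ.* suc n′) * ℕtoℚ (m′ ℕ.+ n′)
Kbip-meanRowSum m′ n′ = begin
  meanRowSum G * ℕtoℚ (m ℕ.+ n)
    ≡⟨ meanRowSum-* G ⟩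
  trace (CNRS G)
    ≡⟨ solve 2 (λ T D → T := (T :+ D) :- D) refl (trace (CNRS G)) (ℕtoℚ D) ⟩
  trace (CNRS G) + ℕtoℚ D - ℕtoℚ D
    ≡⟨ cong₂ _-_ (trace-CNRS+diagonal (Kbip-profile m n)) (cong ℕtoℚ (Σℕ-sides m n (λ a → sideCN m n a a))) ⟩
  ℕtoℚ ((m ℕ.+ n) ℕ.* (m ℕ.* n)) - ℕtoℚ (m ℕ.* n ℕ.+ n ℕ.* m)
    ≡⟨ cong₂ _-_ (trans (ℕtoℚ-* (m ℕ.+ n) (m ℕ.* n)) (cong (λ k → ℕtoℚ k * q) (suc+suc≡2+ m′ n′)))
                 (trans (ℕtoℚ-+ (m ℕ.* n) (n ℕ.* m)) (cong (q +_) (cong ℕtoℚ (ℕP.*-comm n m)))) ⟩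
  ℕtoℚ (2 ℕ.+ s) * q - (q + q)
    ≡⟨ cong (λ z → z * q - (q + q)) (ℕtoℚ-+ 2 s) ⟩
  (ℕtoℚ 2 + ℕtoℚ s) * q - (q + q)
    ≡⟨ solve 2 (λ S q → (con (ℕtoℚ 2) :+ S) :* q :- (q :+ q) := q :* S) refl (ℕtoℚ s) q ⟩
  q * ℕtoℚ s ∎
  where
  open ≡-Reasoning
  m = suc m′
  n = suc n′
  s = m′ ℕ.+ n′
  q = ℕtoℚ (m ℕ.* n)
  G = Kbip m n
  D = Σℕ {m ℕ.+ n} (λ i → bipartiteCN m n i i)

Kbip-meanRowSum-bounds : ∀ m′ n′ →
  0ℚ ≤ meanRowSum (Kbip (suc m′) (suc n′)) × meanRowSum (Kbip (suc m′) (suc n′)) ≤ ℕtoℚ (suc m′ ℕ.* suc n′)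
Kbip-meanRowSum-bounds m′ n′ = cancel (begin
    0ℚ * P                  ≡⟨ ℚP.*-zeroˡ P ⟩
    0ℚ                      ≤⟨ ℕtoℚ-mono-≤ {0} {m ℕ.* n ℕ.* s} z≤n ⟩
    ℕtoℚ (m ℕ.* n ℕ.* s)    ≡⟨ ℕtoℚ-* (m ℕ.* n) s ⟩
    q * ℕtoℚ s              ≡⟨ Kbip-meanRowSum m′ n′ ⟨
    c * P                   ∎)
  , cancel (begin
    c * P                         ≡⟨ Kbip-meanRowSum m′ n′ ⟩
    q * ℕtoℚ s                    ≡⟨ ℕtoℚ-* (m ℕ.* n) s ⟨
    ℕtoℚ (m ℕ.* n ℕ.* s)          ≤⟨ ℕtoℚ-mono-≤ (ℕP.*-monoʳ-≤ (m ℕ.* n) s≤m+n) ⟩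
    ℕtoℚ (m ℕ.* n ℕ.* (m ℕ.+ n))  ≡⟨ ℕtoℚ-* (m ℕ.* n) (m ℕ.+ n) ⟩
    q * P                         ∎)
  where
  open ℚP.≤-Reasoning
  m = suc m′
  n = suc n′
  s = m′ ℕ.+ n′
  P = ℕtoℚ (m ℕ.+ n)
  q = ℕtoℚ (m ℕ.* n)
  c = meanRowSum (Kbip m n)
  cancel = *-cancelʳ-≤-ℕtoℚ-suc (m′ ℕ.+ suc n′)
  s≤m+n : s ℕ.≤ m ℕ.+ n
  s≤m+n = subst (s ℕ.≤_) (sym (suc+suc≡2+ m′ n′)) (ℕP.m≤n+m s 2)

Kbip-energy : ∀ m′ n′ (α : Vec ℚ (suc m′ ℕ.+ suc n′)) → IsSpectrum (CNL (Kbip (suc m′) (suc n′))) α →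
  let c = meanRowSum (Kbip (suc m′) (suc n′)) in
  LEfrom (Kbip (suc m′) (suc n′)) α ≡ ℕtoℚ 2 * c + ℕtoℚ (m′ ℕ.+ n′) * (ℕtoℚ (suc m′ ℕ.* suc n′) - c)
Kbip-energy m′ n′ α spec = trans (absDevSum≡ c)
  (cong₂ _+_ (cong₂ (λ k v → ℕtoℚ k * v) #0≡2 (∣0-c∣≡c 0≤c)) (cong₂ (λ k v → ℕtoℚ k * v) #q≡s (∣q-c∣≡q-c c≤q)))
  where
  m = suc m′
  n = suc n′
  s = m′ ℕ.+ n′
  q = ℕtoℚ (m ℕ.* n)
  c = meanRowSum (Kbip m n)
  0≤c = proj₁ (Kbip-meanRowSum-bounds m′ n′)
  c≤q = proj₂ (Kbip-meanRowSum-bounds m′ n′)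
  roots : All (λ ν → ν ≡ 0ℚ ⊎ ν ≡ q) α
  roots = All.map (λ {ν} → monomial-root {ν} 2 s)
    (spectrum-roots (CNL (Kbip m n)) (λ x → x ^ 2 * (x - q) ^ s) (charPoly-Kbip m′ n′) spec)
  open Census (census q α roots)
  #0≡2 : #0 ≡ 2
  #0≡2 = zero-multiplicity (ℕtoℚ-suc≢0 (n′ ℕ.+ m′ ℕ.* n)) (trans #0+#q≡k (suc+suc≡2+ m′ n′))
    (λ x → trans (sym (rootProduct≡ x)) (trans (sym (spec x)) (charPoly-Kbip m′ n′ x)))
  #q≡s : #q ≡ s
  #q≡s = ℕP.+-cancelˡ-≡ 2 #q s (trans (cong (ℕ._+ #q) (sym #0≡2)) (trans #0+#q≡k (suc+suc≡2+ m′ n′)))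

-- Since c·p = q·s and p = s + 2, the energy 2c + s(q − c) of K_{m,n} equals 4qs/p.
Kbip-energy-upper : ∀ m′ n′ (α : Vec ℚ (suc m′ ℕ.+ suc n′)) → IsSpectrum (CNL (Kbip (suc m′) (suc n′))) α →
  LEfrom (Kbip (suc m′) (suc n′)) α ≤ ℕtoℚ (suc m′ ℕ.+ suc n′) * ℕtoℚ (m′ ℕ.+ n′)
Kbip-energy-upper m′ n′ α spec = *-cancelʳ-≤-ℕtoℚ-suc (m′ ℕ.+ suc n′) (begin
  LEfrom (Kbip m n) α * P
    ≡⟨ cong (_* P) (Kbip-energy m′ n′ α spec) ⟩
  (ℕtoℚ 2 * c + S * (q - c)) * P
    ≡⟨ solve 4 (λ c S q P → (con (ℕtoℚ 2) :* c :+ S :* (q :- c)) :* P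
                             := (con (ℕtoℚ 2) :- S) :* (c :* P) :+ S :* q :* P) refl c S q P ⟩
  (ℕtoℚ 2 - S) * (c * P) + S * q * P
    ≡⟨ cong₂ (λ u v → (ℕtoℚ 2 - S) * u + S * q * v) (Kbip-meanRowSum m′ n′)
             (trans (cong ℕtoℚ (suc+suc≡2+ m′ n′)) (ℕtoℚ-+ 2 s)) ⟩
  (ℕtoℚ 2 - S) * (q * S) + S * q * (ℕtoℚ 2 + S)
    ≡⟨ solve 2 (λ S q → (con (ℕtoℚ 2) :- S) :* (q :* S) :+ S :* q :* (con (ℕtoℚ 2) :+ S)
                         := con (ℕtoℚ 4) :* q :* S) refl S q ⟩
  ℕtoℚ 4 * q * S
    ≡⟨ trans (ℕtoℚ-* (4 ℕ.* (m ℕ.* n)) s) (cong (_* S) (ℕtoℚ-* 4 (m ℕ.* n))) ⟨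
  ℕtoℚ (4 ℕ.* (m ℕ.* n) ℕ.* s)
    ≤⟨ ℕtoℚ-mono-≤ (ℕP.*-monoˡ-≤ s (4mn≤[m+n]² m n)) ⟩
  ℕtoℚ ((m ℕ.+ n) ℕ.* (m ℕ.+ n) ℕ.* s)
    ≡⟨ trans (ℕtoℚ-* ((m ℕ.+ n) ℕ.* (m ℕ.+ n)) s) (cong (_* S) (ℕtoℚ-* (m ℕ.+ n) (m ℕ.+ n))) ⟩
  P * P * S
    ≡⟨ solve 2 (λ P S → P :* P :* S := P :* S :* P) refl P S ⟩
  P * S * P ∎)
  where
  open ℚP.≤-Reasoning
  m = suc m′
  n = suc n′
  s = m′ ℕ.+ n′
  P = ℕtoℚ (m ℕ.+ n)
  S = ℕtoℚ s
  q = ℕtoℚ (m ℕ.* n)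
  c = meanRowSum (Kbip m n)

proposition3p4 : (m n : ℕ) → 1 ℕ.≤ m → 1 ℕ.≤ n →
    (Σ[ α ∈ Vec ℚ (m ℕ.+ n) ] IsSpectrum (CNL (Kbip m n)) α)
    × (Σ[ β ∈ Vec ℚ (m ℕ.+ n) ] IsSpectrum (CNL (K (m ℕ.+ n))) β)
    × ((α β : Vec ℚ (m ℕ.+ n)) → IsSpectrum (CNL (Kbip m n)) α → IsSpectrum (CNL (K (m ℕ.+ n))) β →
    LEfrom (Kbip m n) α ≤ LEfrom (K (m ℕ.+ n)) β)
proposition3p4 (suc m′) (suc n′) _ _ =
  Kbip-spectrum m′ n′ ,
  K-spectrum (suc+suc≡2+ m′ n′) ,
  λ α β α-spec β-spec → ℚP.≤-trans (Kbip-energy-upper m′ n′ α α-spec) (K-energy-lower (suc+suc≡2+ m′ n′) β β-spec)
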